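{- Let $H$ be a finite graph and $q\ge 1$ an integer. Then there is a partition of $E(H)$ into sets $M_0,M_1,\ldots, M_n$ for some $n\ge 0$ (where $M_0$ may be empty) such that: there is a subset $X\subseteq V(H)$ with $|X|\le 2q-2$ such that every edge in $M_0$ is incident with a vertex in $X$; and $M_1,\ldots, M_n$ are all matchings, each of cardinality exactly $q$.
   Context: A matching is a set of pairwise vertex-disjoint edges. -}

module Defs where

open import Data.Nat using (ℕ)
open import Data.Bool using (Bool; T)
open import Data.Fin using (Fin; _<_)
open import Data.Fin.Subset using (Subset; _∈_; ∣_∣)
open import Data.Product using (Σ; _×_; _,_)
open import Data.Sum using (_⊎_)
open import Relation.Binary.PropositionalEquality using (_≡_)
open import Relation.Nullary using (¬_)

record Graph (n : ℕ) : Set where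
  field
    adj   : Fin n → Fin n → Bool
    sym   : ∀ i j → adj i j ≡ adj j i
    irref : ∀ i → adj i i ≡ Data.Bool.false

open Graph public

-- An edge of H: an unordered pair {u , w} with u < w (canonical orientation)
-- and u adjacent to w.  Equality of edges is propositional equality.
record Edge {n : ℕ} (H : Graph n) : Set where
  constructor edge
  field
    u   : Fin n
    w   : Fin n
    u<w : u < w
    isE : T (adj H u w)

open Edge public

_incident_ : {n : ℕ} {H : Graph n} → Fin n → Edge H → Set
x incident e = (x ≡ u e) ⊎ (x ≡ w e)

shareVertex : {n : ℕ} {H : Graph n} → Edge H → Edge H → Set
shareVertex {n} e f = Σ (Fin n) λ x → (x incident e) × (x incident f)

-- Choose greedily a maximal matching M among the edges not yet assigned to a
-- class.  If |M| < q, maximality says that every remaining edge meets one of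
-- the at most 2q − 2 endpoints of M, and the remaining edges form M₀.
-- Otherwise any q edges of M form the next matching Mᵢ, and we recurse on the
-- strictly smaller set of edges still unassigned.
module Submission where

open import Defs
open import Data.Nat as ℕ using (ℕ; _≤_; _*_; _∸_)
open import Data.Fin using (Fin; zero; suc)
open import Data.Fin.Subset using (Subset; _∈_; ∣_∣)
open import Data.Product using (Σ; _×_; _,_)
open import Function.Bundles using (_⤖_)
open import Relation.Binary.PropositionalEquality using (_≡_)
open import Relation.Nullary using (¬_)

open import Data.Nat using (_+_; _<_; s≤s; z≤n)
open import Axiom.UniquenessOfIdentityProofs using (module Decidable⇒UIP)
open import Data.Bool using (true; false)
open import Data.Bool.Properties using (T-irrelevant)
open import Data.Empty using (⊥-elim)
import Data.Fin as F
open import Data.Fin.Properties using (<-irrelevant; _<?_)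
open import Data.Fin.Subset using (⊥; ⁅_⁆; _∪_)
open import Data.Fin.Subset.Properties using (∣⊥∣≡0; ∣⁅x⁆∣≡1; x∈⁅x⁆; p⊆p∪q; q⊆p∪q)
open import Data.List
  using (List; []; _∷_; length; lookup; take; filter; mapMaybe; cartesianProduct; allFin)
open import Data.List.Properties using (length-take; filter-notAll)
open import Data.List.Membership.Propositional using (find) renaming (_∈_ to _∈ₗ_; _∉_ to _∉ₗ_)
open import Data.List.Membership.Propositional.Properties
  using (∈-lookup; ∈-map⁺; ∈-filter⁺; ∈-filter⁻; ∈-cartesianProduct⁺; ∈-allFin)
import Data.List.Membership.DecPropositional as DecMembership
open import Data.List.Relation.Unary.All as All using (All; []; _∷_)
open import Data.List.Relation.Unary.All.Properties using (¬Any⇒All¬)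
import Data.List.Relation.Unary.All.Properties as All
open import Data.List.Relation.Unary.AllPairs as AllPairs using (AllPairs; []; _∷_)
import Data.List.Relation.Unary.AllPairs.Properties as AllPairs
open import Data.List.Relation.Unary.Any as Any using (Any; here; there; index; any?)
open import Data.List.Relation.Unary.Any.Properties using (lookup-index; mapMaybe⁺)
open import Data.List.Relation.Unary.Unique.Propositional using (Unique)
open import Data.Maybe using (Maybe; just; nothing)
import Data.Maybe.Relation.Unary.Any as Maybe
open import Data.Nat.Induction using (<-wellFounded)
open import Data.Nat.Properties
  using (≤-trans; ≤-reflexive; +-monoʳ-≤; n≤1+n; +-suc; *-suc; *-monoʳ-≤; *-distribˡ-∸; <⇒≤pred; ≰⇒>
        ; m≤n⇒m⊓n≡m; _≤?_; module ≤-Reasoning)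
open import Data.Product using (proj₁; proj₂; ∃; map₂)
open import Data.Sum using (_⊎_; inj₁; inj₂)
open import Data.Vec using ([]; _∷_)
open import Function using (_∘_)
open import Function.Bundles using (mk⤖; mk↔ₛ′)
open import Function.Construct.Composition using (_⤖-∘_)
open import Function.Consequences.Propositional using (strictlySurjective⇒surjective)
open import Function.Properties.Inverse using (↔⇒⤖)
open import Induction.WellFounded using (Acc; acc)
open import Relation.Binary using (Decidable; DecidableEquality)
open import Relation.Binary.PropositionalEquality using (refl; trans; cong; cong₂; subst; _≢_)
import Relation.Binary.PropositionalEquality as ≡
open import Relation.Nullary using (Dec; yes; no; Irrelevant)
open import Relation.Nullary.Decidable using (map′; _×-dec_; _⊎-dec_; T?)

module _ {A : Set} where

  Σ-≡-irrelevant : {P : A → Set} → (∀ {a} → Irrelevant (P a)) →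
                   ∀ {a b} {p : P a} {q : P b} → a ≡ b → (a , p) ≡ (b , q)
  Σ-≡-irrelevant irr refl = cong (_ ,_) (irr _ _)

  Σ-⤖-irrelevant : {P Q : A → Set} →
                   (∀ {a} → Irrelevant (P a)) → (∀ {a} → Irrelevant (Q a)) →
                   (∀ {a} → P a → Q a) → (∀ {a} → Q a → P a) → Σ A P ⤖ Σ A Q
  Σ-⤖-irrelevant irrP irrQ P⇒Q Q⇒P = ↔⇒⤖ (mk↔ₛ′ (map₂ P⇒Q) (map₂ Q⇒P)
    (λ _ → Σ-≡-irrelevant irrQ refl) (λ _ → Σ-≡-irrelevant irrP refl))

  lookup-injective : ∀ {xs : List A} → Unique xs →
                     ∀ {i j} → lookup xs i ≡ lookup xs j → i ≡ j
  lookup-injective {_ ∷ _} (_ ∷ _)  {zero}  {zero}  _  = refl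
  lookup-injective {_ ∷ _} (x∉ ∷ _) {zero}  {suc j} eq = ⊥-elim (All.lookup x∉ (∈-lookup j) eq)
  lookup-injective {_ ∷ _} (x∉ ∷ _) {suc i} {zero}  eq = ⊥-elim (All.lookup x∉ (∈-lookup i) (≡.sym eq))
  lookup-injective {_ ∷ _} (_ ∷ u)  {suc i} {suc j} eq = cong suc (lookup-injective u eq)

  Unique⇒lookup-⤖ : {P : A → Set} {xs : List A} → Unique xs → (∀ {a} → Irrelevant (P a)) →
                    (∀ {a} → a ∈ₗ xs → P a) → (∀ {a} → P a → a ∈ₗ xs) →
                    Fin (length xs) ⤖ Σ A P
  Unique⇒lookup-⤖ {P} {xs} unique irr ∈⇒P P⇒∈ =
    mk⤖ {to = to} (injective , strictlySurjective⇒surjective surjective)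
    where
      to : Fin (length xs) → Σ A P
      to i = lookup xs i , ∈⇒P (∈-lookup i)

      injective : ∀ {i j} → to i ≡ to j → i ≡ j
      injective = lookup-injective unique ∘ cong proj₁

      surjective : ∀ y → ∃ λ i → to i ≡ y
      surjective (a , p) = index (P⇒∈ p) , Σ-≡-irrelevant irr (≡.sym (lookup-index (P⇒∈ p)))

∈-mapMaybe⁺ : {A B : Set} (f : A → Maybe B) {x : A} {y : B} {xs : List A} →
              x ∈ₗ xs → f x ≡ just y → y ∈ₗ mapMaybe f xs
∈-mapMaybe⁺ f {xs = xs} x∈xs fx≡y = mapMaybe⁺ f xs (Any.map just-y (∈-map⁺ f x∈xs))
  where
    just-y : ∀ {z} → f _ ≡ z → Maybe.Any (_ ≡_) z
    just-y fx≡z = subst (Maybe.Any (_ ≡_)) (trans (≡.sym fx≡y) fx≡z) (Maybe.just refl)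

Fin-irrelevant : ∀ {n} {i j : Fin n} → Irrelevant (i ≡ j)
Fin-irrelevant = Decidable⇒UIP.≡-irrelevant F._≟_

∣p∪q∣≤∣p∣+∣q∣ : ∀ {n} (p q : Subset n) → ∣ p ∪ q ∣ ≤ ∣ p ∣ + ∣ q ∣
∣p∪q∣≤∣p∣+∣q∣ []          []          = z≤n
∣p∪q∣≤∣p∣+∣q∣ (true ∷ p)  (true ∷ q)  =
  s≤s (≤-trans (∣p∪q∣≤∣p∣+∣q∣ p q) (+-monoʳ-≤ ∣ p ∣ (n≤1+n ∣ q ∣)))
∣p∪q∣≤∣p∣+∣q∣ (true ∷ p)  (false ∷ q) = s≤s (∣p∪q∣≤∣p∣+∣q∣ p q)
∣p∪q∣≤∣p∣+∣q∣ (false ∷ p) (true ∷ q)  =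
  ≤-trans (s≤s (∣p∪q∣≤∣p∣+∣q∣ p q)) (≤-reflexive (≡.sym (+-suc ∣ p ∣ ∣ q ∣)))
∣p∪q∣≤∣p∣+∣q∣ (false ∷ p) (false ∷ q) = ∣p∪q∣≤∣p∣+∣q∣ p q

module _ {A : Set} {_~_ : A → A → Set} (_~?_ : Decidable _~_) where

  greedy : List A → List A
  greedy [] = []
  greedy (x ∷ xs) with any? (x ~?_) (greedy xs)
  ... | yes _ = greedy xs
  ... | no _  = x ∷ greedy xs

  greedy-⊆ : ∀ xs → All (_∈ₗ xs) (greedy xs)
  greedy-⊆ [] = []
  greedy-⊆ (x ∷ xs) with any? (x ~?_) (greedy xs)
  ... | yes _ = All.map there (greedy-⊆ xs)
  ... | no _  = here refl ∷ All.map there (greedy-⊆ xs)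

  greedy-independent : ∀ xs → AllPairs (λ x y → ¬ x ~ y) (greedy xs)
  greedy-independent [] = []
  greedy-independent (x ∷ xs) with any? (x ~?_) (greedy xs)
  ... | yes _    = greedy-independent xs
  ... | no ¬x~ys = ¬Any⇒All¬ _ ¬x~ys ∷ greedy-independent xs

  greedy-maximal : (∀ x → x ~ x) → ∀ xs → All (λ x → Any (x ~_) (greedy xs)) xs
  greedy-maximal ~-refl [] = []
  greedy-maximal ~-refl (x ∷ xs) with any? (x ~?_) (greedy xs)
  ... | yes x~ys = x~ys ∷ greedy-maximal ~-refl xs
  ... | no _     = here (~-refl x) ∷ All.map there (greedy-maximal ~-refl xs)

module _ {v : ℕ} {H : Graph v} where

  edge-≡ : ∀ {e f : Edge H} → u e ≡ u f → w e ≡ w f → e ≡ f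
  edge-≡ {edge a b a<b ab} {edge _ _ a<b′ ab′} refl refl
    rewrite <-irrelevant a<b a<b′ | T-irrelevant ab ab′ = refl

  _≟ₑ_ : DecidableEquality (Edge H)
  e ≟ₑ f = map′ (λ (uu , ww) → edge-≡ uu ww) (λ e≡f → cong u e≡f , cong w e≡f)
                (u e F.≟ u f ×-dec w e F.≟ w f)

  incident? : (x : Fin v) (e : Edge H) → Dec (x incident e)
  incident? x e = x F.≟ u e ⊎-dec x F.≟ w e

  shareVertex-refl : ∀ (e : Edge H) → shareVertex e e
  shareVertex-refl e = u e , inj₁ refl , inj₁ refl

  shareVertex-sym : ∀ {e f : Edge H} → shareVertex e f → shareVertex f e
  shareVertex-sym (x , x∈e , x∈f) = x , x∈f , x∈e

  shareVertex? : Decidable (shareVertex {v} {H})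
  shareVertex? e f = map′ from-endpoint to-endpoint (incident? (u e) f ⊎-dec incident? (w e) f)
    where
      from-endpoint : (u e incident f) ⊎ (w e incident f) → shareVertex e f
      from-endpoint (inj₁ ue∈f) = u e , inj₁ refl , ue∈f
      from-endpoint (inj₂ we∈f) = w e , inj₂ refl , we∈f

      to-endpoint : shareVertex e f → (u e incident f) ⊎ (w e incident f)
      to-endpoint (_ , inj₁ refl , x∈f) = inj₁ x∈f
      to-endpoint (_ , inj₂ refl , x∈f) = inj₂ x∈f

  Matching : List (Edge H) → Set
  Matching = AllPairs (λ e f → ¬ shareVertex e f)

  Matching⇒Unique : ∀ {M} → Matching M → Unique M
  Matching⇒Unique = AllPairs.map λ {e} ¬e~f e≡f →
    ¬e~f (subst (shareVertex {H = H} e) e≡f (shareVertex-refl e))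

  Matching-disjoint : ∀ {M e f} → Matching M → e ∈ₗ M → f ∈ₗ M → e ≢ f → ¬ shareVertex e f
  Matching-disjoint (_ ∷ _)     (here refl) (here refl) e≢f = ⊥-elim (e≢f refl)
  Matching-disjoint (¬e~M ∷ _)  (here refl) (there f∈M) _   = All.lookup ¬e~M f∈M
  Matching-disjoint {e = e} {f} (¬f~M ∷ _) (there e∈M) (here refl) _ =
    All.lookup ¬f~M e∈M ∘ shareVertex-sym {e = e} {f}
  Matching-disjoint (_ ∷ match) (there e∈M) (there f∈M) e≢f =
    Matching-disjoint match e∈M f∈M e≢f

  endpoints : List (Edge H) → Subset v
  endpoints [] = ⊥
  endpoints (e ∷ M) = ⁅ u e ⁆ ∪ (⁅ w e ⁆ ∪ endpoints M)

  ∣endpoints∣≤ : ∀ M → ∣ endpoints M ∣ ≤ 2 * length M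
  ∣endpoints∣≤ [] = ≤-reflexive (∣⊥∣≡0 v)
  ∣endpoints∣≤ (e ∷ M) = begin
    ∣ ⁅ u e ⁆ ∪ (⁅ w e ⁆ ∪ endpoints M) ∣
      ≤⟨ ∣p∪q∣≤∣p∣+∣q∣ ⁅ u e ⁆ _ ⟩
    ∣ ⁅ u e ⁆ ∣ + ∣ ⁅ w e ⁆ ∪ endpoints M ∣
      ≤⟨ +-monoʳ-≤ ∣ ⁅ u e ⁆ ∣ (∣p∪q∣≤∣p∣+∣q∣ ⁅ w e ⁆ (endpoints M)) ⟩
    ∣ ⁅ u e ⁆ ∣ + (∣ ⁅ w e ⁆ ∣ + ∣ endpoints M ∣)
      ≡⟨ cong₂ (λ a b → a + (b + ∣ endpoints M ∣)) (∣⁅x⁆∣≡1 (u e)) (∣⁅x⁆∣≡1 (w e)) ⟩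
    2 + ∣ endpoints M ∣
      ≤⟨ +-monoʳ-≤ 2 (∣endpoints∣≤ M) ⟩
    2 + 2 * length M
      ≡⟨ ≡.sym (*-suc 2 (length M)) ⟩
    2 * length (e ∷ M) ∎
    where open ≤-Reasoning

  incident⇒∈endpoints : ∀ {M e x} → e ∈ₗ M → x incident e → x ∈ endpoints M
  incident⇒∈endpoints {f ∷ M} (here refl) (inj₁ refl) =
    p⊆p∪q (⁅ w f ⁆ ∪ endpoints M) (x∈⁅x⁆ (u f))
  incident⇒∈endpoints {f ∷ M} (here refl) (inj₂ refl) =
    q⊆p∪q ⁅ u f ⁆ _ (p⊆p∪q (endpoints M) (x∈⁅x⁆ (w f)))
  incident⇒∈endpoints {f ∷ M} (there e∈M) x∈e =
    q⊆p∪q ⁅ u f ⁆ _ (q⊆p∪q ⁅ w f ⁆ (endpoints M) (incident⇒∈endpoints e∈M x∈e))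

module _ {v : ℕ} (H : Graph v) where

  toEdge : Fin v × Fin v → Maybe (Edge H)
  toEdge (a , b) with a <? b | T? (adj H a b)
  ... | yes a<b | yes ab = just (edge a b a<b ab)
  ... | _       | _      = nothing

  toEdge-endpoints : ∀ e → toEdge (u e , w e) ≡ just e
  toEdge-endpoints (edge a b a<b ab) with a <? b | T? (adj H a b)
  ... | yes _   | yes _  = cong just (edge-≡ refl refl)
  ... | no a≮b  | _      = ⊥-elim (a≮b a<b)
  ... | yes _   | no ¬ab = ⊥-elim (¬ab ab)

  allEdges : List (Edge H)
  allEdges = mapMaybe toEdge (cartesianProduct (allFin v) (allFin v))

  ∈-allEdges : ∀ e → e ∈ₗ allEdges
  ∈-allEdges e = ∈-mapMaybe⁺ toEdge
    (∈-cartesianProduct⁺ (∈-allFin (u e)) (∈-allFin (w e))) (toEdge-endpoints e)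

module _ {P : Set} {n : ℕ} where

  prependClass : Dec P → Fin (ℕ.suc n) → Fin (ℕ.suc (ℕ.suc n))
  prependClass (yes _) _       = suc zero
  prependClass (no _)  zero    = zero
  prependClass (no _)  (suc k) = suc (suc k)

  prependClass-zero⁻ : ∀ d c → prependClass d c ≡ zero → ¬ P × c ≡ zero
  prependClass-zero⁻ (yes _) _       ()
  prependClass-zero⁻ (no ¬p) zero    _  = ¬p , refl
  prependClass-zero⁻ (no _)  (suc _) ()

  prependClass-one⁻ : ∀ d c → prependClass d c ≡ suc zero → P
  prependClass-one⁻ (yes p) _       _  = p
  prependClass-one⁻ (no _)  zero    ()
  prependClass-one⁻ (no _)  (suc _) ()

  prependClass-one⁺ : ∀ d c → P → prependClass d c ≡ suc zero
  prependClass-one⁺ (yes _) _ _ = refl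
  prependClass-one⁺ (no ¬p) _ p = ⊥-elim (¬p p)

  prependClass-shift⁻ : ∀ d c {k} → prependClass d c ≡ suc (suc k) → c ≡ suc k
  prependClass-shift⁻ (yes _) _       ()
  prependClass-shift⁻ (no _)  zero    ()
  prependClass-shift⁻ (no _)  (suc _) refl = refl

  prependClass-shift⁺ : ∀ d {c k} → ¬ P → c ≡ suc k → prependClass d c ≡ suc (suc k)
  prependClass-shift⁺ (yes p) ¬p _    = ⊥-elim (¬p p)
  prependClass-shift⁺ (no _)  _  refl = refl

module _ {v : ℕ} {H : Graph v} (q : ℕ) where

  open DecMembership (_≟ₑ_ {H = H}) using (_∈?_; _∉?_)

  -- Colour zero is M₀ and colour suc k the matching Mₖ₊₁.  Only the edges of R
  -- are decomposed: M₀ need be covered only on R, and every Mₖ₊₁ lies in R.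
  record Decomposition (R : List (Edge H)) : Set where
    field
      n          : ℕ
      colour     : Edge H → Fin (ℕ.suc n)
      cover      : Subset v
      ∣cover∣≤   : ∣ cover ∣ ≤ 2 * q ∸ 2
      covers     : ∀ e → e ∈ₗ R → colour e ≡ zero → Σ (Fin v) λ x → (x ∈ cover) × (x incident e)
      matching   : ∀ k e f → colour e ≡ suc k → colour f ≡ suc k → ¬ (e ≡ f) → ¬ shareVertex e f
      class-size : ∀ k → Fin q ⤖ Σ (Edge H) λ e → colour e ≡ suc k
      class⊆     : ∀ k e → colour e ≡ suc k → e ∈ₗ R

  coveredByMatching : ∀ {R} M → All (λ e → Any (shareVertex e) M) R → length M < q →
                      Decomposition R
  coveredByMatching M dominated |M|<q = record
    { n          = 0
    ; colour     = λ _ → zero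
    ; cover      = endpoints M
    ; ∣cover∣≤   = ≤-trans (∣endpoints∣≤ M) 2|M|≤2q-2
    ; covers     = λ e e∈R _ → covered {e} (find (All.lookup dominated e∈R))
    ; matching   = λ ()
    ; class-size = λ ()
    ; class⊆     = λ ()
    }
    where
      2|M|≤2q-2 : 2 * length M ≤ 2 * q ∸ 2
      2|M|≤2q-2 = ≤-trans (*-monoʳ-≤ 2 (<⇒≤pred |M|<q)) (≤-reflexive (*-distribˡ-∸ 2 q 1))

      covered : ∀ {e} → ∃ (λ f → f ∈ₗ M × shareVertex e f) →
                Σ (Fin v) λ x → (x ∈ endpoints M) × (x incident e)
      covered (f , f∈M , x , x∈e , x∈f) = x , incident⇒∈endpoints f∈M x∈f , x∈e

  addClass : ∀ {R} M → Matching M → length M ≡ q → All (_∈ₗ R) M →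
             Decomposition (filter (_∉? M) R) → Decomposition R
  addClass {R} M matchingM |M|≡q M⊆R D = record
    { n          = ℕ.suc n
    ; colour     = colour′
    ; cover      = cover
    ; ∣cover∣≤   = ∣cover∣≤
    ; covers     = covers′
    ; matching   = matching′
    ; class-size = class-size′
    ; class⊆     = class⊆′
    }
    where
      open Decomposition D

      colour′ : Edge H → Fin (ℕ.suc (ℕ.suc n))
      colour′ e = prependClass (e ∈? M) (colour e)

      old-class-∉ : ∀ {k e} → colour e ≡ suc k → e ∉ₗ M
      old-class-∉ {k} {e} ce = proj₂ (∈-filter⁻ (_∉? M) {xs = R} (class⊆ k e ce))

      covers′ : ∀ e → e ∈ₗ R → colour′ e ≡ zero → Σ (Fin v) λ x → (x ∈ cover) × (x incident e)
      covers′ e e∈R c′e with prependClass-zero⁻ (e ∈? M) (colour e) c′e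
      ... | e∉M , ce = covers e (∈-filter⁺ (_∉? M) e∈R e∉M) ce

      matching′ : ∀ k e f → colour′ e ≡ suc k → colour′ f ≡ suc k → ¬ (e ≡ f) → ¬ shareVertex e f
      matching′ zero e f c′e c′f = Matching-disjoint matchingM
        (prependClass-one⁻ (e ∈? M) _ c′e) (prependClass-one⁻ (f ∈? M) _ c′f)
      matching′ (suc k) e f c′e c′f = matching k e f
        (prependClass-shift⁻ (e ∈? M) _ c′e) (prependClass-shift⁻ (f ∈? M) _ c′f)

      class-size′ : ∀ k → Fin q ⤖ Σ (Edge H) λ e → colour′ e ≡ suc k
      class-size′ zero = subst (λ m → Fin m ⤖ Σ (Edge H) λ e → colour′ e ≡ suc zero) |M|≡q
        (Unique⇒lookup-⤖ (Matching⇒Unique matchingM) Fin-irrelevant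
          (prependClass-one⁺ (_ ∈? M) _) (prependClass-one⁻ (_ ∈? M) _))
      class-size′ (suc k) = Σ-⤖-irrelevant Fin-irrelevant Fin-irrelevant
          (λ ce → prependClass-shift⁺ (_ ∈? M) (old-class-∉ ce) ce)
          (prependClass-shift⁻ (_ ∈? M) _)
        ⤖-∘ class-size k

      class⊆′ : ∀ k e → colour′ e ≡ suc k → e ∈ₗ R
      class⊆′ zero e c′e = All.lookup M⊆R (prependClass-one⁻ (e ∈? M) _ c′e)
      class⊆′ (suc k) e c′e =
        proj₁ (∈-filter⁻ (_∉? M) {xs = R} (class⊆ k e (prependClass-shift⁻ (e ∈? M) _ c′e)))

  filter-∉-shorter : ∀ {R} M → 1 ≤ length M → All (_∈ₗ R) M →
                     length (filter (_∉? M) R) < length R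
  filter-∉-shorter (e ∷ M) _ (e∈R ∷ _) =
    filter-notAll (_∉? (e ∷ M)) _ (Any.map (λ { refl e∉ → e∉ (here refl) }) e∈R)

  decompose : 1 ≤ q → ∀ R → Acc _<_ (length R) → Decomposition R
  decompose 1≤q R (acc shorter) = coverOrAddClass (q ≤? length M)
    where
      M = greedy shareVertex? R

      coverOrAddClass : Dec (q ≤ length M) → Decomposition R
      coverOrAddClass (no |M|≱q) =
        coveredByMatching M (greedy-maximal shareVertex? shareVertex-refl R) (≰⇒> |M|≱q)
      coverOrAddClass (yes q≤|M|) = addClass M′ matchingM′ |M′|≡q M′⊆R
        (decompose 1≤q (filter (_∉? M′) R) (shorter (filter-∉-shorter M′ 1≤|M′| M′⊆R)))
        where
          M′ = take q M

          |M′|≡q : length M′ ≡ q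
          |M′|≡q = trans (length-take q M) (m≤n⇒m⊓n≡m q≤|M|)

          1≤|M′| : 1 ≤ length M′
          1≤|M′| = subst (1 ≤_) (≡.sym |M′|≡q) 1≤q

          matchingM′ : Matching M′
          matchingM′ = AllPairs.take⁺ q (greedy-independent shareVertex? R)

          M′⊆R : All (_∈ₗ R) M′
          M′⊆R = All.take⁺ q (greedy-⊆ shareVertex? R)

mainTheorem4 : (v : ℕ) (H : Graph v) (q : ℕ) → 1 ≤ q →
    Σ ℕ λ n → Σ (Edge H → Fin (ℕ.suc n)) λ c →
      (Σ (Subset v) λ X → (∣ X ∣ ≤ 2 * q ∸ 2)
          × (∀ e → c e ≡ zero → Σ (Fin v) λ x → (x ∈ X) × (x incident e)))
      × (∀ (k : Fin n) →
           (∀ e f → c e ≡ suc k → c f ≡ suc k → ¬ (e ≡ f) → ¬ shareVertex e f)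
           × (Fin q ⤖ Σ (Edge H) λ e → c e ≡ suc k))
mainTheorem4 v H q 1≤q =
  n , colour , (cover , ∣cover∣≤ , λ e → covers e (∈-allEdges H e)) , λ k → matching k , class-size k
  where open Decomposition (decompose q 1≤q (allEdges H) (<-wellFounded _))
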